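{- Let $G=(V,E)$ be a finite undirected graph with edge costs $c_e\ge 0$, let $\lambda_1\ge 0$, and let $y$ be the dual values produced by the primal-dual subroutine $PD(\lambda_1)$ described in the context (at any moment of its execution, in particular at termination). Then for every $S\subseteq V$, $$\sum_{U\subseteq S}y_U\le \lambda_1|S|.$$
   Context: Potential: for $S\subseteq V$, $\pi(S)=\lambda_1|S|-\sum_{T\subsetneq S}y_T$. The primal-dual subroutine $PD(\lambda_1)$: initially $y_S=0$ for all $S\subseteq V$, the forest $F$ is empty, and the active components are the singletons $\{v\}$, $v\in V$; the current components always partition $V$ and each is active or inactive. While some component is active, the values $y_C$ of all active components $C$ are raised continuously and uniformly until one of the following events occurs: (set event) some active component $C$ satisfies $y_C=\pi(C)$; then $C$ is marked inactive (neutral) and remains a component; (edge event) some edge $e$ between two distinct current components $S_1,S_2$, at least one of them active, satisfies $\sum_{S:e\in\delta(S)}y_S=c_e$; then $e$ is added to $F$, $S_1,S_2$ are marked inactive and replaced by the new active component $S_1\cup S_2$. Ties are broken by some fixed rule. Only the $y$ values of active components are ever increased.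
   Formalization: The edge costs $c_e$, the parameter $\lambda_1$ and the dual values $y$ are taken in the rationals. -}

module Defs where

open import Data.Nat using (ℕ; zero; suc)
open import Data.Bool using (Bool; true; false; _xor_; _∨_)
open import Data.Integer using (+_)
open import Data.Rational using (ℚ; 0ℚ; _+_; _*_; _-_; _≤_; _/_)
open import Data.Fin using (Fin)
open import Data.Fin.Subset using (Subset; _⊆_; _⊂_; _∈_; _∪_; ⁅_⁆; ∣_∣; inside; outside)
open import Data.Fin.Subset.Properties using (_⊆?_; _⊂?_; _∈?_)
open import Data.Vec using (_∷_; [])
open import Data.List using (List; []; _∷_; map; _++_; filter; foldr)
open import Data.List.Membership.Propositional renaming (_∈_ to _∈ᴸ_; _∉_ to _∉ᴸ_)
open import Data.List.Relation.Binary.Permutation.Propositional using (_↭_)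
open import Data.Product using (_×_; _,_; proj₁; proj₂; Σ)
open import Data.Sum using (_⊎_)
open import Relation.Nullary.Decidable using (⌊_⌋)
open import Relation.Binary.PropositionalEquality using (_≡_)
open import Data.List using (allFin)

allSubsets : (n : ℕ) → List (Subset n)
allSubsets zero = [] ∷ []
allSubsets (suc n) = map (outside ∷_) (allSubsets n) ++ map (inside ∷_) (allSubsets n)

sumℚ : List ℚ → ℚ
sumℚ = foldr _+_ 0ℚ

ℕ→ℚ : ℕ → ℚ
ℕ→ℚ k = (+ k) / 1

-- An (undirected) edge {u,v} with cost c: (u , v , c).  The graph is a list
-- of such edges (multi-edges allowed; loops never cross any cut).
Edge : ℕ → Set
Edge n = Fin n × Fin n × ℚ

endpoint₁ : ∀ {n} → Edge n → Fin n
endpoint₁ (u , v , c) = u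

endpoint₂ : ∀ {n} → Edge n → Fin n
endpoint₂ (u , v , c) = v

cost : ∀ {n} → Edge n → ℚ
cost (u , v , c) = c

crosses : ∀ {n} → Edge n → Subset n → Bool
crosses (u , v , c) S = ⌊ u ∈? S ⌋ xor ⌊ v ∈? S ⌋

Dual : ℕ → Set
Dual n = Subset n → ℚ

sumSub : ∀ {n} → Dual n → Subset n → ℚ
sumSub {n} y S = sumℚ (map y (filter (_⊆? S) (allSubsets n)))

sumProper : ∀ {n} → Dual n → Subset n → ℚ
sumProper {n} y S = sumℚ (map y (filter (_⊂? S) (allSubsets n)))

load : ∀ {n} → Dual n → Edge n → ℚ
load {n} y e = sumℚ (map y (filter (λ S → Data.Bool._≟_ (crosses e S) true) (allSubsets n)))

potential : ∀ {n} → ℚ → Dual n → Subset n → ℚ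
potential λ₁ y S = λ₁ * ℕ→ℚ ∣ S ∣ - sumProper y S

-- A current component together with its activity flag (true = active).
Component : ℕ → Set
Component n = Subset n × Bool

-- State of PD(λ₁): dual values and the current components (a partition of V).
-- (The forest F does not influence y and is not recorded.)
record State (n : ℕ) : Set where
  constructor ⟨_,_⟩
  field
    y     : Dual n
    comps : List (Component n)
open State public

initialComps : (n : ℕ) → List (Component n)
initialComps n = map (λ v → (⁅ v ⁆ , true)) (allFin n)

data Step {n : ℕ} (E : List (Edge n)) (λ₁ : ℚ) : State n → State n → Set where
  -- Uniform raise by δ ≥ 0 of y_C for all active components C, stopping no later
  -- than the first event: afterwards no active C has y_C > π(C) and no edge
  -- between distinct components (at least one active) is over-tight.
  raise : ∀ (y y' : Dual n) (cs : List (Component n)) (δ : ℚ)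
        → 0ℚ ≤ δ
        → (∀ U → (U , true) ∈ᴸ cs → y' U ≡ y U + δ)
        → (∀ U → (U , true) ∉ᴸ cs → y' U ≡ y U)
        → (∀ C → (C , true) ∈ᴸ cs → y' C ≤ potential λ₁ y' C)
        → (∀ e → e ∈ᴸ E → ∀ C → (C , true) ∈ᴸ cs → crosses e C ≡ true → load y' e ≤ cost e)
        → Step E λ₁ ⟨ y , cs ⟩ ⟨ y' , cs ⟩
  setEvent : ∀ (y : Dual n) (cs rest : List (Component n)) (C : Subset n)
        → cs ↭ ((C , true) ∷ rest)
        → y C ≡ potential λ₁ y C
        → Step E λ₁ ⟨ y , cs ⟩ ⟨ y , (C , false) ∷ rest ⟩
  edgeEvent : ∀ (y : Dual n) (cs rest : List (Component n)) (S₁ S₂ : Subset n) (a₁ a₂ : Bool) (e : Edge n)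
        → cs ↭ ((S₁ , a₁) ∷ (S₂ , a₂) ∷ rest)
        → a₁ ∨ a₂ ≡ true
        → e ∈ᴸ E
        → ((endpoint₁ e ∈ S₁ × endpoint₂ e ∈ S₂) ⊎ (endpoint₂ e ∈ S₁ × endpoint₁ e ∈ S₂))
        → load y e ≡ cost e
        → Step E λ₁ ⟨ y , cs ⟩ ⟨ y , (S₁ ∪ S₂ , true) ∷ rest ⟩

-- States reachable at some moment of an execution of PD(λ₁)
-- (for every tie-breaking rule).
data Reachable {n : ℕ} (E : List (Edge n)) (λ₁ : ℚ) : State n → Set where
  start : ∀ (y : Dual n) → (∀ U → y U ≡ 0ℚ) → Reachable E λ₁ ⟨ y , initialComps n ⟩
  step  : ∀ {s t} → Reachable E λ₁ s → Step E λ₁ s t → Reachable E λ₁ t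

-- Throughout the run y ≥ 0 and every set with y_U ≠ 0 is a nonempty subset of one of the
-- current components, which stay pairwise disjoint.  Since no such U straddles a component,
-- Σ_{U ⊆ S} y_U is at most the sum of Σ_{U ⊆ S ∩ C} y_U over the components C, while
-- |S| = Σ_C |S ∩ C|; so it suffices to bound sets T lying inside a single component.
-- Set and edge events leave y alone and only relabel or merge components.  After a raise,
-- an active component T satisfies y_T ≤ π(T), which is exactly the bound at T once the
-- term U = T is split off; for any other T no active component lies below T, so the sum
-- over the subsets of T has not changed.

module Submission where

open import Defs
open import Algebra.Bundles using (CommutativeMonoid)
open import Algebra.Properties.Group using (//-rightDividesˡ)
open import Data.Bool using (true) renaming (_≟_ to _≟ᵇ_)
open import Data.Empty using (⊥; ⊥-elim)
open import Data.Fin using (Fin)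
open import Data.Fin.Subset using (Subset; inside; outside; _⊆_; _⊂_; _∈_; _∩_; _∪_; ∁; ∣_∣; Nonempty; ⁅_⁆)
open import Data.Fin.Subset.Properties
  using (_∈?_; _⊆?_; _⊂?_; ⊆-reflexive; ⊆-antisym; x∈p∩q⁺; x∉p⇒x∈∁p; x∈∁p⇒x∉p;
         x∈p∪q⁻; p∩q⊆p; p∩q⊆q; p⊆p∪q; q⊆p∪q; x∈⁅x⁆; x∈⁅y⁆⇒x≡y)
import Data.Integer as ℤ
import Data.Integer.Properties as ℤ
open import Data.List using (List; []; _∷_; map; filter; _++_)
import Data.List.Properties as List
open import Data.List.Membership.Propositional using () renaming (_∈_ to _∈ᴸ_; _∉_ to _∉ᴸ_)
open import Data.List.Membership.Propositional.Properties using (∈-map⁺)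
open import Data.List.Relation.Binary.Permutation.Propositional using (_↭_; ↭⇒↭ₛ)
open import Data.List.Relation.Binary.Permutation.Propositional.Properties as ↭ using (All-resp-↭; Any-resp-↭)
import Data.List.Relation.Binary.Permutation.Setoid.Properties as Permₛ
open import Data.List.Relation.Unary.All as All using (All; []; _∷_)
import Data.List.Relation.Unary.All.Properties as All
open import Data.List.Relation.Unary.AllPairs as AllPairs using (AllPairs; []; _∷_)
import Data.List.Relation.Unary.AllPairs.Properties as AllPairs
open import Data.List.Relation.Unary.Any as Any using (Any; here; there)
open import Data.List.Relation.Unary.Unique.Propositional.Properties using (allFin⁺)
open import Data.Nat as ℕ using (ℕ; zero; suc)
import Data.Nat.Properties as ℕ
open import Data.Nat.Coprimality as Coprime using (1-coprimeTo)
open import Data.Product as Product using (_×_; _,_; proj₁)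
import Data.Product.Properties as Product
open import Data.Rational using (ℚ; mkℚ; 0ℚ; _≤_; _*_; _+_; _-_; _/_; nonNegative)
open import Data.Rational.Properties
open import Data.Sum as Sum using (_⊎_; inj₁; inj₂)
open import Data.Vec using ([]; _∷_)
import Data.Vec.Properties as Vec
open import Function using (_∘_)
open import Relation.Binary using (DecidableEquality)
open import Relation.Binary.PropositionalEquality
  using (_≡_; _≢_; refl; sym; trans; cong; cong₂; subst; setoid; resp₂; module ≡-Reasoning)
open import Relation.Nullary using (Dec; yes; no; ¬_)
open import Relation.Unary using (Decidable)

private
  variable
    A : Set
    n : ℕ

p≤p+q : ∀ {p q} → 0ℚ ≤ q → p ≤ p + q
p≤p+q {p} 0≤q = ≤-trans (≤-reflexive (sym (+-identityʳ p))) (+-monoʳ-≤ p 0≤q)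

p≤q+p : ∀ {p q} → 0ℚ ≤ q → p ≤ q + p
p≤q+p {p} 0≤q = ≤-trans (≤-reflexive (sym (+-identityˡ p))) (+-monoˡ-≤ p 0≤q)

nonNeg+nonNeg : ∀ {p q} → 0ℚ ≤ p → 0ℚ ≤ q → 0ℚ ≤ p + q
nonNeg+nonNeg 0≤p 0≤q = ≤-trans 0≤p (p≤p+q 0≤q)

nonNeg*nonNeg : ∀ {p q} → 0ℚ ≤ p → 0ℚ ≤ q → 0ℚ ≤ p * q
nonNeg*nonNeg {p} {q} 0≤p 0≤q =
  nonNegative⁻¹ (p * q) {{nonNeg*nonNeg⇒nonNeg p {{nonNegative 0≤p}} q {{nonNegative 0≤q}}}}

infixl 7 _when_

_when_ : {P : Set} → ℚ → Dec P → ℚ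
q when yes _ = q
q when no _  = 0ℚ

when-nonNeg : {P : Set} (p : Dec P) {q : ℚ} → 0ℚ ≤ q → 0ℚ ≤ q when p
when-nonNeg (yes _) 0≤q = 0≤q
when-nonNeg (no _)  _   = ≤-refl

when-≤-+ : {P Q R : Set} (p : Dec P) (q : Dec Q) (r : Dec R) {x : ℚ} → 0ℚ ≤ x →
           (P → x ≡ 0ℚ ⊎ Q ⊎ R) → x when p ≤ x when q + x when r
when-≤-+ (no _) q r 0≤x _ = nonNeg+nonNeg (when-nonNeg q 0≤x) (when-nonNeg r 0≤x)
when-≤-+ (yes P) q r 0≤x cover with cover P | q | r
... | inj₁ x≡0      | q     | r     =
  ≤-trans (≤-reflexive x≡0) (nonNeg+nonNeg (when-nonNeg q 0≤x) (when-nonNeg r 0≤x))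
... | inj₂ (inj₁ Q) | yes _ | r     = p≤p+q (when-nonNeg r 0≤x)
... | inj₂ (inj₁ Q) | no ¬Q | _     = ⊥-elim (¬Q Q)
... | inj₂ (inj₂ R) | q     | yes _ = p≤q+p (when-nonNeg q 0≤x)
... | inj₂ (inj₂ R) | _     | no ¬R = ⊥-elim (¬R R)

when-⇔ : {P Q : Set} → (P → Q) → (Q → P) → (p : Dec P) (q : Dec Q) {x : ℚ} → x when p ≡ x when q
when-⇔ P⇒Q Q⇒P (yes _) (yes _) = refl
when-⇔ P⇒Q Q⇒P (yes P) (no ¬Q) = ⊥-elim (¬Q (P⇒Q P))
when-⇔ P⇒Q Q⇒P (no ¬P) (yes Q) = ⊥-elim (¬P (Q⇒P Q))
when-⇔ P⇒Q Q⇒P (no _)  (no _)  = refl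

when-¬ : {P : Set} → ¬ P → (p : Dec P) {x : ℚ} → x when p ≡ 0ℚ
when-¬ ¬P (yes P) = ⊥-elim (¬P P)
when-¬ ¬P (no _)  = refl

sum-++ : (ps qs : List ℚ) → sumℚ (ps ++ qs) ≡ sumℚ ps + sumℚ qs
sum-++ []       qs = sym (+-identityˡ (sumℚ qs))
sum-++ (p ∷ ps) qs = trans (cong (p +_) (sum-++ ps qs)) (sym (+-assoc p _ _))

sum-map-cong : {f g : A → ℚ} (xs : List A) → (∀ x → f x ≡ g x) →
               sumℚ (map f xs) ≡ sumℚ (map g xs)
sum-map-cong []       _   = refl
sum-map-cong (x ∷ xs) f≗g = cong₂ _+_ (f≗g x) (sum-map-cong xs f≗g)

sum-map-zero : {f : A → ℚ} (xs : List A) → (∀ x → f x ≡ 0ℚ) → sumℚ (map f xs) ≡ 0ℚ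
sum-map-zero []       _    = refl
sum-map-zero (x ∷ xs) f≗0 = trans (cong₂ _+_ (f≗0 x) (sum-map-zero xs f≗0)) (+-identityˡ 0ℚ)

sum-map-mono-≤ : {f g : A → ℚ} (xs : List A) → (∀ x → f x ≤ g x) →
                 sumℚ (map f xs) ≤ sumℚ (map g xs)
sum-map-mono-≤ []       _   = ≤-refl
sum-map-mono-≤ (x ∷ xs) f≤g = +-mono-≤ (f≤g x) (sum-map-mono-≤ xs f≤g)

sum-map-+ : (f g : A → ℚ) (xs : List A) →
            sumℚ (map (λ x → f x + g x) xs) ≡ sumℚ (map f xs) + sumℚ (map g xs)
sum-map-+ f g []       = sym (+-identityˡ 0ℚ)
sum-map-+ f g (x ∷ xs) = trans (cong (f x + g x +_) (sum-map-+ f g xs)) (+-interchange (f x) (g x) _ _)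
  where open import Algebra.Properties.CommutativeSemigroup
          (CommutativeMonoid.commutativeSemigroup +-0-commutativeMonoid)
          using () renaming (interchange to +-interchange)

sum-filter : {P : A → Set} (P? : Decidable P) (f : A → ℚ) (xs : List A) →
             sumℚ (map f (filter P? xs)) ≡ sumℚ (map (λ x → f x when P? x) xs)
sum-filter P? f []       = refl
sum-filter P? f (x ∷ xs) with P? x
... | yes _ = cong (f x +_) (sum-filter P? f xs)
... | no _  = trans (sum-filter P? f xs) (sym (+-identityˡ _))

sum-filter-cong : {P : A → Set} (P? : Decidable P) {f g : A → ℚ} (xs : List A) →
                  (∀ x → P x → f x ≡ g x) → sumℚ (map f (filter P? xs)) ≡ sumℚ (map g (filter P? xs))
sum-filter-cong P? []       _   = refl
sum-filter-cong P? (x ∷ xs) f≗g with P? x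
... | yes Px = cong₂ _+_ (f≗g x Px) (sum-filter-cong P? xs f≗g)
... | no _   = sum-filter-cong P? xs f≗g

sum-filter-≤-+ : {P Q R : A → Set} (P? : Decidable P) (Q? : Decidable Q) (R? : Decidable R)
  (f : A → ℚ) (xs : List A) → (∀ x → 0ℚ ≤ f x) → (∀ x → P x → f x ≡ 0ℚ ⊎ Q x ⊎ R x) →
  sumℚ (map f (filter P? xs)) ≤ sumℚ (map f (filter Q? xs)) + sumℚ (map f (filter R? xs))
sum-filter-≤-+ P? Q? R? f xs 0≤f cover = begin
  sumℚ (map f (filter P? xs))                           ≡⟨ sum-filter P? f xs ⟩
  sumℚ (map (λ x → f x when P? x) xs)                   ≤⟨ sum-map-mono-≤ xs split ⟩
  sumℚ (map (λ x → f x when Q? x + f x when R? x) xs)   ≡⟨ sum-map-+ _ _ xs ⟩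
  sumℚ (map (λ x → f x when Q? x) xs) + sumℚ (map (λ x → f x when R? x) xs)
    ≡⟨ sym (cong₂ _+_ (sum-filter Q? f xs) (sum-filter R? f xs)) ⟩
  sumℚ (map f (filter Q? xs)) + sumℚ (map f (filter R? xs)) ∎
  where
  open ≤-Reasoning
  split : ∀ x → f x when P? x ≤ f x when Q? x + f x when R? x
  split x = when-≤-+ (P? x) (Q? x) (R? x) (0≤f x) (cover x)

infix 4 _≟ₛ_

_≟ₛ_ : DecidableEquality (Subset n)
_≟ₛ_ = Vec.≡-dec _≟ᵇ_

sum-allSubsets-suc : (f : Subset (suc n) → ℚ) → sumℚ (map f (allSubsets (suc n))) ≡
  sumℚ (map (f ∘ (outside ∷_)) (allSubsets n)) + sumℚ (map (f ∘ (inside ∷_)) (allSubsets n))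
sum-allSubsets-suc {n} f = begin
  sumℚ (map f (map (outside ∷_) Us ++ map (inside ∷_) Us))
    ≡⟨ cong sumℚ (List.map-++ f (map (outside ∷_) Us) (map (inside ∷_) Us)) ⟩
  sumℚ (map f (map (outside ∷_) Us) ++ map f (map (inside ∷_) Us))
    ≡⟨ sum-++ (map f (map (outside ∷_) Us)) _ ⟩
  sumℚ (map f (map (outside ∷_) Us)) + sumℚ (map f (map (inside ∷_) Us))
    ≡⟨ sym (cong₂ (λ ps qs → sumℚ ps + sumℚ qs) (List.map-∘ Us) (List.map-∘ Us)) ⟩
  sumℚ (map (f ∘ (outside ∷_)) Us) + sumℚ (map (f ∘ (inside ∷_)) Us) ∎
  where
  open ≡-Reasoning
  Us = allSubsets n

sum-when-∷≢∷ : ∀ {b c} (f : Subset (suc n) → ℚ) (D : Subset n) (Us : List (Subset n)) → b ≢ c →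
  sumℚ (map (λ U → f (b ∷ U) when (b ∷ U ≟ₛ c ∷ D)) Us) ≡ 0ℚ
sum-when-∷≢∷ {b = b} {c} f D Us b≢c =
  sum-map-zero Us λ U → when-¬ (b≢c ∘ Vec.∷-injectiveˡ) (b ∷ U ≟ₛ c ∷ D)

sum-when-∷≟∷ : ∀ {b} (f : Subset (suc n) → ℚ) (D : Subset n) (Us : List (Subset n)) →
  sumℚ (map (λ U → f (b ∷ U) when (b ∷ U ≟ₛ b ∷ D)) Us) ≡ sumℚ (map (λ U → f (b ∷ U) when (U ≟ₛ D)) Us)
sum-when-∷≟∷ {b = b} f D Us =
  sum-map-cong Us λ U → when-⇔ Vec.∷-injectiveʳ (cong (b ∷_)) (b ∷ U ≟ₛ b ∷ D) (U ≟ₛ D)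

sum-when-≟ : (f : Subset n → ℚ) (D : Subset n) →
             sumℚ (map (λ U → f U when (U ≟ₛ D)) (allSubsets n)) ≡ f D
sum-when-≟ {zero}  f []            = +-identityʳ (f [])
sum-when-≟ {suc n} f (outside ∷ D) =
  trans (sum-allSubsets-suc (λ U → f U when (U ≟ₛ outside ∷ D)))
    (trans (cong₂ _+_ (trans (sum-when-∷≟∷ f D Us) (sum-when-≟ (f ∘ (outside ∷_)) D))
                      (sum-when-∷≢∷ {b = inside} {c = outside} f D Us λ ()))
           (+-identityʳ _))
  where Us = allSubsets n
sum-when-≟ {suc n} f (inside ∷ D) =
  trans (sum-allSubsets-suc (λ U → f U when (U ≟ₛ inside ∷ D)))
    (trans (cong₂ _+_ (sum-when-∷≢∷ {b = outside} {c = inside} f D Us λ ())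
                      (trans (sum-when-∷≟∷ f D Us) (sum-when-≟ (f ∘ (inside ∷_)) D)))
           (+-identityˡ _))
  where Us = allSubsets n

sum-filter-≟ : (f : Subset n → ℚ) (D : Subset n) → sumℚ (map f (filter (_≟ₛ D) (allSubsets n))) ≡ f D
sum-filter-≟ {n} f D = trans (sum-filter (_≟ₛ D) f (allSubsets n)) (sum-when-≟ f D)

⊆⇒≡⊎⊂ : {U D : Subset n} → U ⊆ D → U ≡ D ⊎ U ⊂ D
⊆⇒≡⊎⊂ {U = U} {D} U⊆D with U ⊂? D
... | yes U⊂D = inj₂ U⊂D
... | no  U⊄D = inj₁ (⊆-antisym U⊆D D⊆U)
  where
  D⊆U : D ⊆ U
  D⊆U {x} x∈D with x ∈? U
  ... | yes x∈U = x∈U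
  ... | no  x∉U = ⊥-elim (U⊄D (U⊆D , x , x∈D , x∉U))

sumSub≤self+sumProper : (y : Dual n) → (∀ U → 0ℚ ≤ y U) → (D : Subset n) →
                        sumSub y D ≤ y D + sumProper y D
sumSub≤self+sumProper y 0≤y D = begin
  sumSub y D                                                        ≤⟨ split ⟩
  sumℚ (map y (filter (_≟ₛ D) (allSubsets _))) + sumProper y D
    ≡⟨ cong (_+ sumProper y D) (sum-filter-≟ y D) ⟩
  y D + sumProper y D                                               ∎
  where
  open ≤-Reasoning
  split = sum-filter-≤-+ (_⊆? D) (_≟ₛ D) (_⊂? D) y (allSubsets _) 0≤y (λ U U⊆D → inj₂ (⊆⇒≡⊎⊂ U⊆D))

sumSub-split : (y : Dual n) → (∀ U → 0ℚ ≤ y U) → (S D : Subset n) →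
  (∀ U → U ⊆ S → y U ≡ 0ℚ ⊎ U ⊆ S ∩ D ⊎ U ⊆ S ∩ ∁ D) →
  sumSub y S ≤ sumSub y (S ∩ D) + sumSub y (S ∩ ∁ D)
sumSub-split y 0≤y S D = sum-filter-≤-+ (_⊆? S) (_⊆? S ∩ D) (_⊆? S ∩ ∁ D) y (allSubsets _) 0≤y

sumSub-cong : {y y′ : Dual n} (S : Subset n) → (∀ U → U ⊆ S → y U ≡ y′ U) → sumSub y S ≡ sumSub y′ S
sumSub-cong S = sum-filter-cong (_⊆? S) (allSubsets _)

sumSub-zero : {y : Dual n} (S : Subset n) → (∀ U → U ⊆ S → y U ≡ 0ℚ) → sumSub y S ≡ 0ℚ
sumSub-zero {n} S y≗0 =
  trans (sumSub-cong S y≗0) (sum-map-zero (filter (_⊆? S) (allSubsets n)) λ _ → refl)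

ℕ→ℚ≡mkℚ : ∀ k → ℕ→ℚ k ≡ mkℚ (ℤ.+ k) 0 (Coprime.sym (1-coprimeTo k))
ℕ→ℚ≡mkℚ k = normalize-coprime (Coprime.sym (1-coprimeTo k))

ℕ→ℚ-+ : ∀ a b → ℕ→ℚ (a ℕ.+ b) ≡ ℕ→ℚ a + ℕ→ℚ b
ℕ→ℚ-+ a b rewrite ℕ→ℚ≡mkℚ a | ℕ→ℚ≡mkℚ b =
  cong (_/ 1) (sym (trans (cong₂ ℤ._+_ (ℤ.*-identityʳ (ℤ.+ a)) (ℤ.*-identityʳ (ℤ.+ b))) (ℤ.pos-+ a b)))

ℕ→ℚ-nonNeg : ∀ k → 0ℚ ≤ ℕ→ℚ k
ℕ→ℚ-nonNeg k = nonNegative⁻¹ (ℕ→ℚ k) {{normalize-nonNeg k 1}}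

∣p∣≡∣p∩q∣+∣p∩∁q∣ : (p q : Subset n) → ∣ p ∣ ≡ ∣ p ∩ q ∣ ℕ.+ ∣ p ∩ ∁ q ∣
∣p∣≡∣p∩q∣+∣p∩∁q∣ []            []            = refl
∣p∣≡∣p∩q∣+∣p∩∁q∣ (inside ∷ p)  (inside ∷ q)  = cong suc (∣p∣≡∣p∩q∣+∣p∩∁q∣ p q)
∣p∣≡∣p∩q∣+∣p∩∁q∣ (inside ∷ p)  (outside ∷ q) = trans (cong suc (∣p∣≡∣p∩q∣+∣p∩∁q∣ p q)) (sym (ℕ.+-suc _ _))
∣p∣≡∣p∩q∣+∣p∩∁q∣ (outside ∷ p) (inside ∷ q)  = ∣p∣≡∣p∩q∣+∣p∩∁q∣ p q
∣p∣≡∣p∩q∣+∣p∩∁q∣ (outside ∷ p) (outside ∷ q) = ∣p∣≡∣p∩q∣+∣p∩∁q∣ p q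

Bounded : ℚ → Dual n → Subset n → Set
Bounded λ₁ y S = sumSub y S ≤ λ₁ * ℕ→ℚ ∣ S ∣

Bounded-zero : ∀ {λ₁} {y : Dual n} → 0ℚ ≤ λ₁ → (S : Subset n) → (∀ U → U ⊆ S → y U ≡ 0ℚ) → Bounded λ₁ y S
Bounded-zero 0≤λ₁ S y≗0 =
  ≤-trans (≤-reflexive (sumSub-zero S y≗0)) (nonNeg*nonNeg 0≤λ₁ (ℕ→ℚ-nonNeg ∣ S ∣))

Bounded-split : (λ₁ : ℚ) (y : Dual n) → (∀ U → 0ℚ ≤ y U) → (S D : Subset n) →
  (∀ U → U ⊆ S → y U ≡ 0ℚ ⊎ U ⊆ S ∩ D ⊎ U ⊆ S ∩ ∁ D) →
  Bounded λ₁ y (S ∩ D) → Bounded λ₁ y (S ∩ ∁ D) → Bounded λ₁ y S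
Bounded-split λ₁ y 0≤y S D cover S∩D-bounded S∖D-bounded = begin
  sumSub y S                                            ≤⟨ sumSub-split y 0≤y S D cover ⟩
  sumSub y (S ∩ D) + sumSub y (S ∩ ∁ D)                 ≤⟨ +-mono-≤ S∩D-bounded S∖D-bounded ⟩
  λ₁ * ℕ→ℚ ∣ S ∩ D ∣ + λ₁ * ℕ→ℚ ∣ S ∩ ∁ D ∣           ≡⟨ sym (*-distribˡ-+ λ₁ _ _) ⟩
  λ₁ * (ℕ→ℚ ∣ S ∩ D ∣ + ℕ→ℚ ∣ S ∩ ∁ D ∣)             ≡⟨ cong (λ₁ *_) (sym (ℕ→ℚ-+ ∣ S ∩ D ∣ ∣ S ∩ ∁ D ∣)) ⟩
  λ₁ * ℕ→ℚ (∣ S ∩ D ∣ ℕ.+ ∣ S ∩ ∁ D ∣)               ≡⟨ cong (λ k → λ₁ * ℕ→ℚ k) (sym (∣p∣≡∣p∩q∣+∣p∩∁q∣ S D)) ⟩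
  λ₁ * ℕ→ℚ ∣ S ∣                                        ∎
  where open ≤-Reasoning

Bounded-potential : (λ₁ : ℚ) (y : Dual n) → (∀ U → 0ℚ ≤ y U) → (T : Subset n) →
                    y T ≤ potential λ₁ y T → Bounded λ₁ y T
Bounded-potential λ₁ y 0≤y T yT≤πT = begin
  sumSub y T                                     ≤⟨ sumSub≤self+sumProper y 0≤y T ⟩
  y T + sumProper y T                            ≤⟨ +-monoˡ-≤ (sumProper y T) yT≤πT ⟩
  λ₁ * ℕ→ℚ ∣ T ∣ - sumProper y T + sumProper y T ≡⟨ //-rightDividesˡ +-0-group (sumProper y T) _ ⟩
  λ₁ * ℕ→ℚ ∣ T ∣                                 ∎
  where open ≤-Reasoning

Disjoint : Subset n → Subset n → Set
Disjoint A B = ∀ {x} → x ∈ A → x ∈ B → ⊥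

Disjoint-sym : {A B : Subset n} → Disjoint A B → Disjoint B A
Disjoint-sym A#B x∈B x∈A = A#B x∈A x∈B

⁅⁆-disjoint : {a b : Fin n} → a ≢ b → Disjoint ⁅ a ⁆ ⁅ b ⁆
⁅⁆-disjoint a≢b x∈⁅a⁆ x∈⁅b⁆ = a≢b (trans (sym (x∈⁅y⁆⇒x≡y _ x∈⁅a⁆)) (x∈⁅y⁆⇒x≡y _ x∈⁅b⁆))

AllPairs-Disjoint-resp-↭ : {ds ds′ : List (Subset n)} → ds ↭ ds′ →
                           AllPairs Disjoint ds → AllPairs Disjoint ds′
AllPairs-Disjoint-resp-↭ {n} ds↭ds′ =
  Permₛ.AllPairs-resp-↭ (setoid (Subset n)) Disjoint-sym (resp₂ Disjoint) (↭⇒↭ₛ ds↭ds′)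

overlapping-members-equal : {ds : List (Subset n)} → AllPairs Disjoint ds →
  ∀ {A B x} → A ∈ᴸ ds → B ∈ᴸ ds → x ∈ A → x ∈ B → A ≡ B
overlapping-members-equal (_  ∷ _)    (here refl) (here refl) _   _   = refl
overlapping-members-equal (A# ∷ _)    (here refl) (there B∈)  x∈A x∈B = ⊥-elim (All.lookup A# B∈ x∈A x∈B)
overlapping-members-equal (B# ∷ _)    (there A∈)  (here refl) x∈A x∈B = ⊥-elim (All.lookup B# A∈ x∈B x∈A)
overlapping-members-equal (_  ∷ disj) (there A∈)  (there B∈)  x∈A x∈B =
  overlapping-members-equal disj A∈ B∈ x∈A x∈B

block-sandwich : {ds : List (Subset n)} → AllPairs Disjoint ds → All Nonempty ds →
  ∀ {U T D} → U ∈ᴸ ds → D ∈ᴸ ds → U ⊆ T → T ⊆ D → U ≡ T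
block-sandwich disjoint nonempty U∈ D∈ U⊆T T⊆D with All.lookup nonempty U∈
... | x , x∈U with overlapping-members-equal disjoint U∈ D∈ x∈U (T⊆D (U⊆T x∈U))
...   | refl = ⊆-antisym U⊆T T⊆D

Carried : Dual n → List (Subset n) → Subset n → Set
Carried y ds U = y U ≡ 0ℚ ⊎ (Nonempty U × Any (U ⊆_) ds)

-- S is cut along the blocks one at a time: nothing in the support of y straddles a block.
Bounded-from-blocks : {λ₁ : ℚ} (y : Dual n) → 0ℚ ≤ λ₁ → (∀ U → 0ℚ ≤ y U) →
  (ds : List (Subset n)) → AllPairs Disjoint ds → All (λ D → ∀ T → T ⊆ D → Bounded λ₁ y T) ds →
  (S : Subset n) → (∀ U → U ⊆ S → Carried y ds U) → Bounded λ₁ y S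
Bounded-from-blocks y 0≤λ₁ 0≤y [] [] [] S carried = Bounded-zero 0≤λ₁ S vanishes
  where
  vanishes : ∀ U → U ⊆ S → y U ≡ 0ℚ
  vanishes U U⊆S with carried U U⊆S
  ... | inj₁ yU≡0    = yU≡0
  ... | inj₂ (_ , ())
Bounded-from-blocks {λ₁ = λ₁} y 0≤λ₁ 0≤y (D ∷ ds) (D# ∷ disj) (D-bounded ∷ ds-bounded) S carried =
  Bounded-split λ₁ y 0≤y S D cover (D-bounded (S ∩ D) (p∩q⊆q S D))
    (Bounded-from-blocks y 0≤λ₁ 0≤y ds disj ds-bounded (S ∩ ∁ D) carried-outside)
  where
  cover : ∀ U → U ⊆ S → y U ≡ 0ℚ ⊎ U ⊆ S ∩ D ⊎ U ⊆ S ∩ ∁ D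
  cover U U⊆S with carried U U⊆S
  ... | inj₁ yU≡0            = inj₁ yU≡0
  ... | inj₂ (_ , here U⊆D)  = inj₂ (inj₁ λ x∈U → x∈p∩q⁺ (U⊆S x∈U , U⊆D x∈U))
  ... | inj₂ (_ , there U⊆B) with All.lookupAny D# U⊆B
  ...   | D#B , U⊆B′ = inj₂ (inj₂ λ x∈U → x∈p∩q⁺ (U⊆S x∈U , x∉p⇒x∈∁p λ x∈D → D#B x∈D (U⊆B′ x∈U)))
  carried-outside : ∀ U → U ⊆ S ∩ ∁ D → Carried y ds U
  carried-outside U U⊆S∖D with carried U (λ x∈U → p∩q⊆p S (∁ D) (U⊆S∖D x∈U))
  ... | inj₁ yU≡0                      = inj₁ yU≡0
  ... | inj₂ (U≠∅ , there U⊆B)          = inj₂ (U≠∅ , U⊆B)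
  ... | inj₂ ((x , x∈U) , here U⊆D)     =
    ⊥-elim (x∈∁p⇒x∉p (p∩q⊆q S (∁ D) (U⊆S∖D x∈U)) (U⊆D x∈U))

record Carrier (y : Dual n) (ds : List (Subset n)) : Set where
  field
    disjoint : AllPairs Disjoint ds
    nonempty : All Nonempty ds
    carried  : ∀ U → Carried y ds U

Carrier-resp-↭ : {y : Dual n} {ds ds′ : List (Subset n)} → ds ↭ ds′ → Carrier y ds → Carrier y ds′
Carrier-resp-↭ ds↭ds′ K = record
  { disjoint = AllPairs-Disjoint-resp-↭ ds↭ds′ disjoint
  ; nonempty = All-resp-↭ ds↭ds′ nonempty
  ; carried  = λ U → Sum.map₂ (Product.map₂ (Any-resp-↭ ds↭ds′)) (carried U)
  }
  where open Carrier K

Carrier-merge : {y : Dual n} {A B : Subset n} {ds : List (Subset n)} →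
                Carrier y (A ∷ B ∷ ds) → Carrier y (A ∪ B ∷ ds)
Carrier-merge {A = A} {B} {ds} K = record
  { disjoint = merged-disjoint disjoint
  ; nonempty = merged-nonempty nonempty
  ; carried  = λ U → Sum.map₂ (Product.map₂ merged-any) (carried U)
  }
  where
  open Carrier K
  merged-disjoint : AllPairs Disjoint (A ∷ B ∷ ds) → AllPairs Disjoint (A ∪ B ∷ ds)
  merged-disjoint ((_ ∷ A#ds) ∷ B#ds ∷ disj) = All.zipWith A∪B# (A#ds , B#ds) ∷ disj
    where
    A∪B# : ∀ {D} → Disjoint A D × Disjoint B D → Disjoint (A ∪ B) D
    A∪B# (A#D , B#D) x∈A∪B x∈D = Sum.[ (λ x∈A → A#D x∈A x∈D) , (λ x∈B → B#D x∈B x∈D) ] (x∈p∪q⁻ A B x∈A∪B)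
  merged-nonempty : All Nonempty (A ∷ B ∷ ds) → All Nonempty (A ∪ B ∷ ds)
  merged-nonempty ((x , x∈A) ∷ _ ∷ ne) = (x , p⊆p∪q B x∈A) ∷ ne
  merged-any : ∀ {U} → Any (U ⊆_) (A ∷ B ∷ ds) → Any (U ⊆_) (A ∪ B ∷ ds)
  merged-any (here U⊆A)         = here (p⊆p∪q B ∘ U⊆A)
  merged-any (there (here U⊆B)) = here (q⊆p∪q A B ∘ U⊆B)
  merged-any (there (there U⊆D)) = there U⊆D

blocks : State n → List (Subset n)
blocks s = map proj₁ (comps s)

record Invariant (λ₁ : ℚ) (s : State n) : Set where
  field
    nonNeg  : ∀ U → 0ℚ ≤ y s U
    carrier : Carrier (y s) (blocks s)
    bounded : ∀ S → Bounded λ₁ (y s) S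

Invariant-initial : ∀ {λ₁} → 0ℚ ≤ λ₁ → (y₀ : Dual n) → (∀ U → y₀ U ≡ 0ℚ) →
                    Invariant λ₁ ⟨ y₀ , initialComps n ⟩
Invariant-initial {n} 0≤λ₁ y₀ y₀≗0 = record
  { nonNeg  = λ U → ≤-reflexive (sym (y₀≗0 U))
  ; carrier = record
    { disjoint = AllPairs.map⁺ (AllPairs.map⁺ (AllPairs.map ⁅⁆-disjoint (allFin⁺ n)))
    ; nonempty = All.map⁺ (All.map⁺ (All.tabulate⁺ λ v → v , x∈⁅x⁆ v))
    ; carried  = λ U → inj₁ (y₀≗0 U)
    }
  ; bounded = λ S → Bounded-zero 0≤λ₁ S λ U _ → y₀≗0 U
  }

_≟ᶜ_ : DecidableEquality (Component n)
_≟ᶜ_ = Product.≡-dec _≟ₛ_ _≟ᵇ_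

module _ {λ₁ : ℚ} {y y′ : Dual n} {cs : List (Component n)} {δ : ℚ} (0≤λ₁ : 0ℚ ≤ λ₁) (0≤δ : 0ℚ ≤ δ)
  (raised : ∀ U → (U , true) ∈ᴸ cs → y′ U ≡ y U + δ)
  (kept : ∀ U → (U , true) ∉ᴸ cs → y′ U ≡ y U)
  (below-potential : ∀ C → (C , true) ∈ᴸ cs → y′ C ≤ potential λ₁ y′ C)
  (I : Invariant λ₁ ⟨ y , cs ⟩)
  where

  open Invariant I
  open Carrier carrier
  open import Data.List.Membership.DecPropositional (_≟ᶜ_ {n}) using () renaming (_∈?_ to _∈ᶜ?_)

  raise-nonNeg : ∀ U → 0ℚ ≤ y′ U
  raise-nonNeg U with (U , true) ∈ᶜ? cs
  ... | yes active   = ≤-trans (nonNeg+nonNeg (nonNeg U) 0≤δ) (≤-reflexive (sym (raised U active)))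
  ... | no  inactive = ≤-trans (nonNeg U) (≤-reflexive (sym (kept U inactive)))

  raise-carried : ∀ U → Carried y′ (blocks ⟨ y , cs ⟩) U
  raise-carried U with (U , true) ∈ᶜ? cs
  ... | yes active   = inj₂ (All.lookup nonempty U∈ , Any.map ⊆-reflexive U∈)
    where U∈ = ∈-map⁺ proj₁ active
  ... | no  inactive = Sum.map₁ (trans (kept U inactive)) (carried U)

  -- An active set below T would be a block squeezed between T and the block D ⊇ T.
  raise-agrees-below : ∀ {T D} → D ∈ᴸ blocks ⟨ y , cs ⟩ → T ⊆ D → (T , true) ∉ᴸ cs →
                       ∀ U → U ⊆ T → y′ U ≡ y U
  raise-agrees-below D∈ T⊆D T-inactive U U⊆T with (U , true) ∈ᶜ? cs
  ... | no  U-inactive = kept U U-inactive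
  ... | yes U-active   = ⊥-elim (T-inactive (subst (λ V → (V , true) ∈ᴸ cs) U≡T U-active))
    where U≡T = block-sandwich disjoint nonempty (∈-map⁺ proj₁ U-active) D∈ U⊆T T⊆D

  raise-bounded-in-blocks : ∀ {D} → D ∈ᴸ blocks ⟨ y , cs ⟩ → ∀ T → T ⊆ D → Bounded λ₁ y′ T
  raise-bounded-in-blocks D∈ T T⊆D with (T , true) ∈ᶜ? cs
  ... | yes T-active   = Bounded-potential λ₁ y′ raise-nonNeg T (below-potential T T-active)
  ... | no  T-inactive =
    ≤-trans (≤-reflexive (sumSub-cong T (raise-agrees-below D∈ T⊆D T-inactive))) (bounded T)

  Invariant-raise : Invariant λ₁ ⟨ y′ , cs ⟩
  Invariant-raise = record
    { nonNeg  = raise-nonNeg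
    ; carrier = record { disjoint = disjoint ; nonempty = nonempty ; carried = raise-carried }
    ; bounded = λ S → Bounded-from-blocks y′ 0≤λ₁ raise-nonNeg (blocks ⟨ y , cs ⟩) disjoint
                        (All.tabulate raise-bounded-in-blocks) S (λ U _ → raise-carried U)
    }

Invariant-step : ∀ {λ₁} {E : List (Edge n)} {s t} → 0ℚ ≤ λ₁ →
                 Step E λ₁ s t → Invariant λ₁ s → Invariant λ₁ t
Invariant-step 0≤λ₁ (raise _ _ _ _ 0≤δ raised kept below-potential _) I =
  Invariant-raise 0≤λ₁ 0≤δ raised kept below-potential I
Invariant-step _ (setEvent _ _ _ _ cs↭ _) I = record
  { nonNeg  = nonNeg
  ; carrier = Carrier-resp-↭ (↭.map⁺ proj₁ cs↭) carrier
  ; bounded = bounded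
  }
  where open Invariant I
Invariant-step _ (edgeEvent _ _ _ _ _ _ _ _ cs↭ _ _ _ _) I = record
  { nonNeg  = nonNeg
  ; carrier = Carrier-merge (Carrier-resp-↭ (↭.map⁺ proj₁ cs↭) carrier)
  ; bounded = bounded
  }
  where open Invariant I

Invariant-reachable : ∀ {λ₁} {E : List (Edge n)} {s} → 0ℚ ≤ λ₁ → Reachable E λ₁ s → Invariant λ₁ s
Invariant-reachable 0≤λ₁ (start y₀ y₀≗0) = Invariant-initial 0≤λ₁ y₀ y₀≗0
Invariant-reachable 0≤λ₁ (step r st)     = Invariant-step 0≤λ₁ st (Invariant-reachable 0≤λ₁ r)

lemma2 : (n : ℕ) (E : List (Edge n)) → All (λ e → 0ℚ ≤ cost e) E
    → (λ₁ : ℚ) → 0ℚ ≤ λ₁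
    → (s : State n) → Reachable E λ₁ s
    → (S : Subset n) → sumSub (y s) S ≤ λ₁ * ℕ→ℚ ∣ S ∣
lemma2 n E _ λ₁ 0≤λ₁ s r = Invariant.bounded (Invariant-reachable 0≤λ₁ r)
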